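{- Let $n\ge5$ be an integer such that $\frac4n$ is an irreducible proper fraction. Then $\frac4n$ has a faithful decomposition of the form \[ \frac4n=\frac1x+\frac1y+\frac rz,\qquad r=1\text{ or }r=2, \] with $x,y,z$ pairwise distinct positive integers.
   Context: A (fraction) decomposition of a positive rational $\frac mn$ is an expression $\frac mn=\frac{a_1}{b_1}+\cdots+\frac{a_k}{b_k}$ where $a_1,\dots,a_k$ are positive integers and $b_1,\dots,b_k$ are pairwise distinct positive integers. For a positive irreducible fraction $u=\frac mn$, such a decomposition is called faithful if for all integers $x_1,\dots,x_k$ with $0\le x_i\le a_i$, the number $v=\sum_{i=1}^k \frac{x_i}{b_i}$ does not lie in $\frac1n\mathbb Z$ unless $v=u$ or $v=0$. -}

module Defs where

open import Data.Nat using (ℕ; zero; suc; _≤_; _<_)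
open import Data.Integer using (ℤ; +_)
open import Data.Rational using (ℚ; _/_; _+_; 0ℚ)
open import Data.List using (List; []; _∷_; map)
open import Data.List.Relation.Unary.All using (All)
open import Data.List.Relation.Unary.Unique.Propositional using (Unique)
open import Data.List.Relation.Binary.Pointwise using (Pointwise)
open import Data.Product using (_×_; _,_; proj₁; proj₂; ∃-syntax)
open import Data.Sum using (_⊎_)
open import Relation.Binary.PropositionalEquality using (_≡_)

-- the rational a / b (for b = 0 it is set to 0; only used with b > 0)
frac : ℕ → ℕ → ℚ
frac a zero    = 0ℚ
frac a (suc d) = (+ a) / suc d

-- a list of terms a_i / b_i, given as pairs (a_i , b_i)
Terms : Set
Terms = List (ℕ × ℕ)

val : List ℕ → Terms → ℚ
val (x ∷ xs) ((a , b) ∷ ds) = frac x b + val xs ds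
val _        _              = 0ℚ

total : Terms → ℚ
total ds = val (map proj₁ ds) ds

InLattice : ℕ → ℚ → Set
InLattice n v = ∃[ k ] v ≡ frac-z k n
  where
  frac-z : ℤ → ℕ → ℚ
  frac-z k zero    = 0ℚ
  frac-z k (suc d) = k / suc d

IsDecomposition : ℕ → ℕ → Terms → Set
IsDecomposition m n ds =
  All (λ p → 0 < proj₁ p × 0 < proj₂ p) ds ×
  Unique (map proj₂ ds) ×
  total ds ≡ frac m n

Faithful : ℕ → ℕ → Terms → Set
Faithful m n ds =
  (xs : List ℕ) → Pointwise (λ x p → x ≤ proj₁ p) xs ds →
  InLattice n (val xs ds) → val xs ds ≡ frac m n ⊎ val xs ds ≡ 0ℚ

-- Since 4/n is irreducible, n ≡ 1 or 3 (mod 4).  For n = 4m + 3 take x = m + 1 and N = nx, so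
-- 4/n = 1/x + 1/N = 1/x + 1/(N + 1) + 1/((N + 1)N).  For n = 4m + 1 with m ≥ 3 take x = m + 1 and
-- s = 2m + 1, so 4/n = 1/x + 3/(nx) = 1/x + 1/(xs) + 2/(ns).  In both cases the terms after 1/x sum
-- to less than 1/n.  Hence a partial sum omitting 1/x lies in [0, 1/n) and one containing it lies in
-- (4/n - 1/n, 4/n]; as distinct points of (1/n)ℤ are at least 1/n apart, the only lattice points
-- there are 0 and 4/n.  For n = 5 and n = 9 no unit fraction lies in (3/n, 4/n], so instead the
-- decompositions 1/2 + 1/4 + 1/20 and 1/4 + 1/6 + 1/36 are checked choice by choice.

module Submission where

open import Defs
open import Data.Empty using (⊥-elim)
open import Data.Integer as ℤ using (ℤ; +_; +≤+; +<+)
import Data.Integer.Properties as ℤ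
open import Data.Integer.Tactic.RingSolver as ℤ-Solver using ()
open import Data.List using (_∷_; [])
open import Data.List.Relation.Binary.Pointwise using (Pointwise; []; _∷_)
open import Data.List.Relation.Unary.All using ([]; _∷_)
open import Data.List.Relation.Unary.AllPairs using ([]; _∷_)
open import Data.Nat as ℕ using (ℕ; NonZero; zero; suc; _+_; _*_; _≤_; _<_; z≤n; s≤s)
open import Data.Nat.Coprimality using (Coprime)
open import Data.Nat.Divisibility using (_∣_; divides; ∣m∣n⇒∣m+n)
import Data.Nat.Properties as ℕ
open import Data.Nat.Tactic.RingSolver as ℕ-Solver using ()
open import Data.Product as Product using (_×_; _,_; proj₁; ∃-syntax)
open import Data.Rational as ℚ using (0ℚ; toℚᵘ) renaming (_+_ to _+ℚ_; _≤_ to _≤ℚ_; _<_ to _<ℚ_)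
import Data.Rational.Properties as ℚ
open import Data.Rational.Unnormalised as ℚᵘ using (mkℚᵘ; *≡*; *≤*; *<*)
import Data.Rational.Unnormalised.Properties as ℚᵘ
open import Data.Sum as Sum using (_⊎_; inj₁; inj₂)
open import Function using (_∘_)
open import Relation.Binary.Definitions using (tri<; tri≈; tri>)
open import Relation.Binary.PropositionalEquality
open import Relation.Nullary using (¬_; contradiction)
open import Relation.Nullary.Decidable using (True; toWitness)

toℚᵘ-frac : ∀ a b → toℚᵘ (frac a (suc b)) ℚᵘ.≃ mkℚᵘ (+ a) b
toℚᵘ-frac a b = ℚ.toℚᵘ-fromℚᵘ (mkℚᵘ (+ a) b)

frac-cong : ∀ a b c d .{{_ : NonZero b}} .{{_ : NonZero d}} → a * d ≡ c * b → frac a b ≡ frac c d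
frac-cong a (suc b) c (suc d) eq = ℚ.fromℚᵘ-cong {mkℚᵘ (+ a) b} {mkℚᵘ (+ c) d} (*≡* (begin
  + a ℤ.* + suc d  ≡⟨ ℤ.pos-* a (suc d) ⟨
  + (a * suc d)    ≡⟨ cong +_ eq ⟩
  + (c * suc b)    ≡⟨ ℤ.pos-* c (suc b) ⟩
  + c ℤ.* + suc b  ∎))
  where open ≡-Reasoning

frac-≤ : ∀ a b c d .{{_ : NonZero b}} .{{_ : NonZero d}} → a * d ≤ c * b → frac a b ≤ℚ frac c d
frac-≤ a (suc b) c (suc d) le = ℚ.toℚᵘ-cancel-≤
  (ℚᵘ.≤-respˡ-≃ (ℚᵘ.≃-sym (toℚᵘ-frac a b)) (ℚᵘ.≤-respʳ-≃ (ℚᵘ.≃-sym (toℚᵘ-frac c d))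
    (*≤* (subst₂ ℤ._≤_ (ℤ.pos-* a (suc d)) (ℤ.pos-* c (suc b)) (+≤+ le)))))

frac-< : ∀ a b c d .{{_ : NonZero b}} .{{_ : NonZero d}} → a * d < c * b → frac a b <ℚ frac c d
frac-< a (suc b) c (suc d) lt = ℚ.toℚᵘ-cancel-<
  (ℚᵘ.<-respˡ-≃ (ℚᵘ.≃-sym (toℚᵘ-frac a b)) (ℚᵘ.<-respʳ-≃ (ℚᵘ.≃-sym (toℚᵘ-frac c d))
    (*<* (subst₂ ℤ._<_ (ℤ.pos-* a (suc d)) (ℤ.pos-* c (suc b)) (+<+ lt)))))

frac-+ : ∀ a b c d .{{_ : NonZero b}} .{{_ : NonZero d}} →
         frac a b +ℚ frac c d ≡ frac (a * d + c * b) (b * d)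
frac-+ a (suc b) c (suc d) = ℚ.toℚᵘ-injective (begin
  toℚᵘ (frac a (suc b) +ℚ frac c (suc d))
    ≈⟨ ℚ.toℚᵘ-homo-+ (frac a (suc b)) (frac c (suc d)) ⟩
  toℚᵘ (frac a (suc b)) ℚᵘ.+ toℚᵘ (frac c (suc d))
    ≈⟨ ℚᵘ.+-cong (toℚᵘ-frac a b) (toℚᵘ-frac c d) ⟩
  mkℚᵘ (+ a ℤ.* + suc d ℤ.+ + c ℤ.* + suc b) (d + b * suc d)
    ≡⟨ cong (λ i → mkℚᵘ i (d + b * suc d)) numerator ⟩
  mkℚᵘ (+ (a * suc d + c * suc b)) (d + b * suc d)
    ≈⟨ toℚᵘ-frac (a * suc d + c * suc b) (d + b * suc d) ⟨
  toℚᵘ (frac (a * suc d + c * suc b) (suc b * suc d))  ∎)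
  where
  open ℚᵘ.≃-Reasoning
  numerator : + a ℤ.* + suc d ℤ.+ + c ℤ.* + suc b ≡ + (a * suc d + c * suc b)
  numerator = trans (cong₂ ℤ._+_ (sym (ℤ.pos-* a (suc d))) (sym (ℤ.pos-* c (suc b))))
                    (sym (ℤ.pos-+ (a * suc d) (c * suc b)))

frac-+≡frac : ∀ a b c d e f .{{_ : NonZero b}} .{{_ : NonZero d}} .{{_ : NonZero f}} →
              (a * d + c * b) * f ≡ e * (b * d) → frac a b +ℚ frac c d ≡ frac e f
frac-+≡frac a b@(suc _) c d@(suc _) e f eq =
  trans (frac-+ a b c d) (frac-cong (a * d + c * b) (b * d) e f eq)

frac-zero : ∀ b → frac 0 b ≡ 0ℚ
frac-zero zero    = refl
frac-zero (suc b) = ℚ.0/n≡0 (suc b)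

frac-monoˡ-≤ : ∀ {a c} b → a ≤ c → frac a b ≤ℚ frac c b
frac-monoˡ-≤         zero      _   = ℚ.≤-refl
frac-monoˡ-≤ {a} {c} b@(suc _) a≤c = frac-≤ a b c b (ℕ.*-monoˡ-≤ b a≤c)

frac-nonNeg : ∀ a b → 0ℚ ≤ℚ frac a b
frac-nonNeg a b = subst (_≤ℚ frac a b) (frac-zero b) (frac-monoˡ-≤ b z≤n)

unit-fraction-split : ∀ N .{{_ : NonZero N}} → frac 1 (1 + N) +ℚ frac 1 ((1 + N) * N) ≡ frac 1 N
unit-fraction-split N@(suc _) = frac-+≡frac 1 (1 + N) 1 ((1 + N) * N) 1 N (identity N)
  where
  identity : ∀ N → (1 * ((1 + N) * N) + 1 * (1 + N)) * N ≡ 1 * ((1 + N) * ((1 + N) * N))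
  identity = ℕ-Solver.solve-∀

val-nonNeg : ∀ xs ds → 0ℚ ≤ℚ val xs ds
val-nonNeg []       _              = ℚ.≤-refl
val-nonNeg (_ ∷ _)  []             = ℚ.≤-refl
val-nonNeg (x ∷ xs) ((_ , b) ∷ ds) = ℚ.+-mono-≤ (frac-nonNeg x b) (val-nonNeg xs ds)

val-≤-total : ∀ {xs ds} → Pointwise (λ x p → x ≤ proj₁ p) xs ds → val xs ds ≤ℚ total ds
val-≤-total []                             = ℚ.≤-refl
val-≤-total {ds = (_ , b) ∷ _} (x≤a ∷ xs≤) = ℚ.+-mono-≤ (frac-monoˡ-≤ b x≤a) (val-≤-total xs≤)

frac∈lattice : ∀ a n → InLattice n (frac a n)
frac∈lattice a zero    = + a , refl
frac∈lattice a (suc n) = + a , refl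

0∈lattice : ∀ n → InLattice n 0ℚ
0∈lattice n = subst (InLattice n) (frac-zero n) (frac∈lattice 0 n)

lattice-gap : ∀ {n p q} .{{_ : NonZero n}} → InLattice n p → InLattice n q → p <ℚ q →
              p +ℚ frac 1 n ≤ℚ q
lattice-gap {suc d} (k , refl) (l , refl) p<q = ℚ.toℚᵘ-cancel-≤ (begin
  toℚᵘ (k ℚ./ suc d +ℚ frac 1 (suc d))
    ≃⟨ ℚ.toℚᵘ-homo-+ (k ℚ./ suc d) (frac 1 (suc d)) ⟩
  toℚᵘ (k ℚ./ suc d) ℚᵘ.+ toℚᵘ (frac 1 (suc d))
    ≃⟨ ℚᵘ.+-cong (ℚ.toℚᵘ-fromℚᵘ (mkℚᵘ k d)) (toℚᵘ-frac 1 d) ⟩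
  mkℚᵘ (k ℤ.* s ℤ.+ + 1 ℤ.* s) (d + d * suc d)
    ≤⟨ *≤* numerator-≤ ⟩
  mkℚᵘ l d
    ≃⟨ ℚ.toℚᵘ-fromℚᵘ (mkℚᵘ l d) ⟨
  toℚᵘ (l ℚ./ suc d)  ∎)
  where
  open ℚᵘ.≤-Reasoning
  s : ℤ
  s = + suc d
  k<l : k ℤ.< l
  k<l = ℤ.*-cancelʳ-<-nonNeg s (ℚᵘ.drop-*<* (ℚᵘ.<-respˡ-≃ (ℚ.toℚᵘ-fromℚᵘ (mkℚᵘ k d))
          (ℚᵘ.<-respʳ-≃ (ℚ.toℚᵘ-fromℚᵘ (mkℚᵘ l d)) (ℚ.toℚᵘ-mono-< p<q))))
  regroup : ∀ k s → (k ℤ.* s ℤ.+ + 1 ℤ.* s) ℤ.* s ≡ (+ 1 ℤ.+ k) ℤ.* (s ℤ.* s)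
  regroup = ℤ-Solver.solve-∀
  numerator-≤ : (k ℤ.* s ℤ.+ + 1 ℤ.* s) ℤ.* s ℤ.≤ l ℤ.* (s ℤ.* s)
  numerator-≤ = subst (ℤ._≤ l ℤ.* (s ℤ.* s)) (sym (regroup k s))
                      (ℤ.*-monoʳ-≤-nonNeg (s ℤ.* s) (ℤ.i<j⇒suc[i]≤j k<l))

lattice-close⇒≡ : ∀ {n p q} .{{_ : NonZero n}} → InLattice n p → InLattice n q →
                  p ≤ℚ q → q <ℚ p +ℚ frac 1 n → p ≡ q
lattice-close⇒≡ {p = p} {q} p∈ q∈ p≤q q<p+1/n with ℚ.<-cmp p q
... | tri< p<q _ _ = contradiction (ℚ.<-≤-trans q<p+1/n (lattice-gap p∈ q∈ p<q)) (ℚ.<-irrefl refl)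
... | tri≈ _ p≡q _ = p≡q
... | tri> _ _ q<p = contradiction (ℚ.<-≤-trans q<p p≤q) (ℚ.<-irrefl refl)

-- For closed n and v the two comparisons are decided by evaluation, so the implicit
-- arguments are filled in automatically.
off-lattice : ∀ j {n v} .{{_ : NonZero n}} →
              {_ : True (frac j n ℚ.<? v)} {_ : True (v ℚ.<? frac (suc j) n)} → ¬ InLattice n v
off-lattice j {n} {v} {j/n<v} {v<j+1/n} v∈ = ℚ.<-irrefl refl (ℚ.<-≤-trans (toWitness v<j+1/n)
  (subst (_≤ℚ v) (frac-+≡frac j n 1 n (suc j) n (identity j n))
    (lattice-gap (frac∈lattice j n) v∈ (toWitness j/n<v))))
  where
  identity : ∀ j n → (j * n + 1 * n) * n ≡ (1 + j) * (n * n)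
  identity = ℕ-Solver.solve-∀

small-tail⇒faithful : ∀ m n .{{_ : NonZero n}} {x} rest → total ((1 , x) ∷ rest) ≡ frac m n →
                      total rest <ℚ frac 1 n → Faithful m n ((1 , x) ∷ rest)
small-tail⇒faithful m n {x} rest _ t<1/n (0 ∷ xs) (z≤n ∷ xs≤) v∈ =
  inj₂ (sym (lattice-close⇒≡ (0∈lattice n) v∈ 0≤v v<1/n))
  where
  v≡w : frac 0 x +ℚ val xs rest ≡ val xs rest
  v≡w = trans (cong (_+ℚ val xs rest) (frac-zero x)) (ℚ.+-identityˡ (val xs rest))
  0≤v : 0ℚ ≤ℚ frac 0 x +ℚ val xs rest
  0≤v = subst (0ℚ ≤ℚ_) (sym v≡w) (val-nonNeg xs rest)
  v<1/n : frac 0 x +ℚ val xs rest <ℚ 0ℚ +ℚ frac 1 n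
  v<1/n = subst₂ _<ℚ_ (sym v≡w) (sym (ℚ.+-identityˡ _)) (ℚ.≤-<-trans (val-≤-total xs≤) t<1/n)
small-tail⇒faithful m n {x} rest u≡ t<1/n (1 ∷ xs) (s≤s z≤n ∷ xs≤) v∈ =
  inj₁ (lattice-close⇒≡ v∈ (frac∈lattice m n) v≤u u<v+1/n)
  where
  open ℚ.≤-Reasoning
  0≤w : 0ℚ ≤ℚ val xs rest
  0≤w = val-nonNeg xs rest
  v≤u : frac 1 x +ℚ val xs rest ≤ℚ frac m n
  v≤u = subst (_ ≤ℚ_) u≡ (ℚ.+-monoʳ-≤ (frac 1 x) (val-≤-total xs≤))
  u<v+1/n : frac m n <ℚ frac 1 x +ℚ val xs rest +ℚ frac 1 n
  u<v+1/n = begin-strict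
    frac m n                              ≡⟨ u≡ ⟨
    frac 1 x +ℚ total rest                <⟨ ℚ.+-monoʳ-< (frac 1 x) t<1/n ⟩
    frac 1 x +ℚ frac 1 n                  ≡⟨ cong (_+ℚ frac 1 n) (ℚ.+-identityʳ (frac 1 x)) ⟨
    frac 1 x +ℚ 0ℚ +ℚ frac 1 n            ≤⟨ ℚ.+-monoˡ-≤ (frac 1 n) (ℚ.+-monoʳ-≤ (frac 1 x) 0≤w) ⟩
    frac 1 x +ℚ val xs rest +ℚ frac 1 n   ∎

FaithfulThreeTerm : ℕ → Set
FaithfulThreeTerm n = ∃[ x ] ∃[ y ] ∃[ z ] ∃[ r ] ((r ≡ 1 ⊎ r ≡ 2) ×
  IsDecomposition 4 n ((1 , x) ∷ (1 , y) ∷ (r , z) ∷ []) ×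
  Faithful 4 n ((1 , x) ∷ (1 , y) ∷ (r , z) ∷ []))

mkFaithfulThreeTerm : ∀ {n x y z r} → (r ≡ 1 ⊎ r ≡ 2) → 0 < x → x < y → y < z →
  total ((1 , x) ∷ (1 , y) ∷ (r , z) ∷ []) ≡ frac 4 n →
  Faithful 4 n ((1 , x) ∷ (1 , y) ∷ (r , z) ∷ []) → FaithfulThreeTerm n
mkFaithfulThreeTerm {x = x} {y} {z} {r} r∈ 0<x x<y y<z sum faithful =
  x , y , z , r , r∈ ,
  ((s≤s z≤n , 0<x) ∷ (s≤s z≤n , 0<y) ∷ (0<r r∈ , ℕ.<-trans 0<y y<z) ∷ [] ,
   (ℕ.<⇒≢ x<y ∷ ℕ.<⇒≢ (ℕ.<-trans x<y y<z) ∷ []) ∷ (ℕ.<⇒≢ y<z ∷ []) ∷ [] ∷ [] ,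
   sum) ,
  faithful
  where
  0<y : 0 < y
  0<y = ℕ.<-trans 0<x x<y
  0<r : r ≡ 1 ⊎ r ≡ 2 → 0 < r
  0<r (inj₁ refl) = s≤s z≤n
  0<r (inj₂ refl) = s≤s z≤n

faithfulThreeTerm-3+m*4 : ∀ m → 1 ≤ m → FaithfulThreeTerm (3 + m * 4)
faithfulThreeTerm-3+m*4 m@(suc _) _ =
  mkFaithfulThreeTerm {n} (inj₁ refl) (s≤s z≤n) x<y y<z sum (small-tail⇒faithful 4 n _ sum tail<1/n)
  where
  n x N y z : ℕ
  n = 3 + m * 4
  x = 1 + m
  N = n * x
  y = 1 + N
  z = y * N
  x<y : x < y
  x<y = s≤s (ℕ.m≤n*m x n)
  y<z : y < z
  y<z = ℕ.m<m*n y N (s≤s (s≤s z≤n))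
  tail : frac 1 y +ℚ (frac 1 z +ℚ 0ℚ) ≡ frac 1 N
  tail = trans (cong (frac 1 y +ℚ_) (ℚ.+-identityʳ (frac 1 z))) (unit-fraction-split N)
  tail<1/n : frac 1 y +ℚ (frac 1 z +ℚ 0ℚ) <ℚ frac 1 n
  tail<1/n = subst (_<ℚ frac 1 n) (sym tail) (frac-< 1 N 1 n
    (subst₂ _<_ (sym (ℕ.*-identityˡ n)) (sym (ℕ.*-identityˡ N)) (ℕ.m<m*n n x (s≤s (s≤s z≤n)))))
  sum-identity : ∀ m → (1 * ((3 + m * 4) * (1 + m)) + 1 * (1 + m)) * (3 + m * 4)
                       ≡ 4 * ((1 + m) * ((3 + m * 4) * (1 + m)))
  sum-identity = ℕ-Solver.solve-∀
  sum : frac 1 x +ℚ (frac 1 y +ℚ (frac 1 z +ℚ 0ℚ)) ≡ frac 4 n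
  sum = trans (cong (frac 1 x +ℚ_) tail) (frac-+≡frac 1 x 1 N 4 n (sum-identity m))

faithfulThreeTerm-1+m*4 : ∀ m → 3 ≤ m → FaithfulThreeTerm (1 + m * 4)
faithfulThreeTerm-1+m*4 m@(suc _) 3≤m =
  mkFaithfulThreeTerm {n} (inj₂ refl) (s≤s z≤n) x<y y<z sum (small-tail⇒faithful 4 n _ sum tail<1/n)
  where
  n x s y z : ℕ
  n = 1 + m * 4
  x = 1 + m
  s = 1 + 2 * m
  y = x * s
  z = n * s
  x<y : x < y
  x<y = ℕ.m<m*n x s (s≤s (s≤s z≤n))
  y<z : y < z
  y<z = ℕ.*-monoˡ-< s (s≤s (ℕ.m<m*n m 4 (s≤s (s≤s z≤n))))
  tail-identity : ∀ m → (1 * ((1 + m * 4) * (1 + 2 * m)) + 2 * ((1 + m) * (1 + 2 * m)))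
                          * ((1 + m * 4) * (1 + m))
                        ≡ 3 * (((1 + m) * (1 + 2 * m)) * ((1 + m * 4) * (1 + 2 * m)))
  tail-identity = ℕ-Solver.solve-∀
  tail : frac 1 y +ℚ (frac 2 z +ℚ 0ℚ) ≡ frac 3 (n * x)
  tail = trans (cong (frac 1 y +ℚ_) (ℚ.+-identityʳ (frac 2 z)))
               (frac-+≡frac 1 y 2 z 3 (n * x) (tail-identity m))
  tail<1/n : frac 1 y +ℚ (frac 2 z +ℚ 0ℚ) <ℚ frac 1 n
  tail<1/n = subst (_<ℚ frac 1 n) (sym tail) (frac-< 3 (n * x) 1 n
    (subst₂ _<_ (ℕ.*-comm n 3) (sym (ℕ.*-identityˡ (n * x))) (ℕ.*-monoʳ-< n (s≤s 3≤m))))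
  sum-identity : ∀ m → (1 * ((1 + m * 4) * (1 + m)) + 3 * (1 + m)) * (1 + m * 4)
                       ≡ 4 * ((1 + m) * ((1 + m * 4) * (1 + m)))
  sum-identity = ℕ-Solver.solve-∀
  sum : frac 1 x +ℚ (frac 1 y +ℚ (frac 2 z +ℚ 0ℚ)) ≡ frac 4 n
  sum = trans (cong (frac 1 x +ℚ_) tail) (frac-+≡frac 1 x 3 (n * x) 4 n (sum-identity m))

faithfulThreeTerm-5 : FaithfulThreeTerm 5
faithfulThreeTerm-5 =
  mkFaithfulThreeTerm {5} (inj₁ refl) (s≤s z≤n) (ℕ.<ᵇ⇒< 2 4 _) (ℕ.<ᵇ⇒< 4 20 _) refl faithful
  where
  faithful : Faithful 4 5 ((1 , 2) ∷ (1 , 4) ∷ (1 , 20) ∷ [])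
  faithful _ (z≤n     ∷ z≤n     ∷ z≤n     ∷ []) _   = inj₂ refl
  faithful _ (z≤n     ∷ z≤n     ∷ s≤s z≤n ∷ []) v∈ = ⊥-elim (off-lattice 0 v∈)
  faithful _ (z≤n     ∷ s≤s z≤n ∷ z≤n     ∷ []) v∈ = ⊥-elim (off-lattice 1 v∈)
  faithful _ (z≤n     ∷ s≤s z≤n ∷ s≤s z≤n ∷ []) v∈ = ⊥-elim (off-lattice 1 v∈)
  faithful _ (s≤s z≤n ∷ z≤n     ∷ z≤n     ∷ []) v∈ = ⊥-elim (off-lattice 2 v∈)
  faithful _ (s≤s z≤n ∷ z≤n     ∷ s≤s z≤n ∷ []) v∈ = ⊥-elim (off-lattice 2 v∈)
  faithful _ (s≤s z≤n ∷ s≤s z≤n ∷ z≤n     ∷ []) v∈ = ⊥-elim (off-lattice 3 v∈)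
  faithful _ (s≤s z≤n ∷ s≤s z≤n ∷ s≤s z≤n ∷ []) _   = inj₁ refl

faithfulThreeTerm-9 : FaithfulThreeTerm 9
faithfulThreeTerm-9 =
  mkFaithfulThreeTerm {9} (inj₁ refl) (s≤s z≤n) (ℕ.<ᵇ⇒< 4 6 _) (ℕ.<ᵇ⇒< 6 36 _) refl faithful
  where
  faithful : Faithful 4 9 ((1 , 4) ∷ (1 , 6) ∷ (1 , 36) ∷ [])
  faithful _ (z≤n     ∷ z≤n     ∷ z≤n     ∷ []) _   = inj₂ refl
  faithful _ (z≤n     ∷ z≤n     ∷ s≤s z≤n ∷ []) v∈ = ⊥-elim (off-lattice 0 v∈)
  faithful _ (z≤n     ∷ s≤s z≤n ∷ z≤n     ∷ []) v∈ = ⊥-elim (off-lattice 1 v∈)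
  faithful _ (z≤n     ∷ s≤s z≤n ∷ s≤s z≤n ∷ []) v∈ = ⊥-elim (off-lattice 1 v∈)
  faithful _ (s≤s z≤n ∷ z≤n     ∷ z≤n     ∷ []) v∈ = ⊥-elim (off-lattice 2 v∈)
  faithful _ (s≤s z≤n ∷ z≤n     ∷ s≤s z≤n ∷ []) v∈ = ⊥-elim (off-lattice 2 v∈)
  faithful _ (s≤s z≤n ∷ s≤s z≤n ∷ z≤n     ∷ []) v∈ = ⊥-elim (off-lattice 3 v∈)
  faithful _ (s≤s z≤n ∷ s≤s z≤n ∷ s≤s z≤n ∷ []) _   = inj₁ refl

odd⇒1-or-3-mod-4 : ∀ n → ¬ 2 ∣ n → ∃[ m ] (n ≡ 1 + m * 4 ⊎ n ≡ 3 + m * 4)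
odd⇒1-or-3-mod-4 0 ¬2∣n = contradiction (divides 0 refl) ¬2∣n
odd⇒1-or-3-mod-4 1 _    = 0 , inj₁ refl
odd⇒1-or-3-mod-4 2 ¬2∣n = contradiction (divides 1 refl) ¬2∣n
odd⇒1-or-3-mod-4 3 _    = 0 , inj₂ refl
odd⇒1-or-3-mod-4 (suc (suc (suc (suc n)))) ¬2∣4+n =
  Product.map suc (Sum.map (cong (λ k → 4 + k)) (cong (λ k → 4 + k)))
    (odd⇒1-or-3-mod-4 n (¬2∣4+n ∘ ∣m∣n⇒∣m+n (divides 2 refl)))

coprime-4⇒odd : ∀ {n} → Coprime 4 n → ¬ 2 ∣ n
coprime-4⇒odd coprime 2∣n = contradiction (coprime (divides 2 refl , 2∣n)) λ ()

theorem1p4 : (n : ℕ) → 5 ≤ n → Coprime 4 n →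
    ∃[ x ] ∃[ y ] ∃[ z ] ∃[ r ] ((r ≡ 1 ⊎ r ≡ 2) ×
    IsDecomposition 4 n ((1 , x) ∷ (1 , y) ∷ (r , z) ∷ []) ×
    Faithful 4 n ((1 , x) ∷ (1 , y) ∷ (r , z) ∷ []))
theorem1p4 n 5≤n coprime with odd⇒1-or-3-mod-4 n (coprime-4⇒odd coprime)
... | 0                     , inj₁ refl = contradiction 5≤n λ { (s≤s ()) }
... | 1                     , inj₁ refl = faithfulThreeTerm-5
... | 2                     , inj₁ refl = faithfulThreeTerm-9
... | m@(suc (suc (suc _))) , inj₁ refl = faithfulThreeTerm-1+m*4 m (s≤s (s≤s (s≤s z≤n)))
... | 0                     , inj₂ refl = contradiction 5≤n λ { (s≤s (s≤s (s≤s ()))) }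
... | m@(suc _)             , inj₂ refl = faithfulThreeTerm-3+m*4 m (s≤s z≤n)
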